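{- (1) Let $S$ be a universal sequence of adjacent transpositions on $[n]$, let $m=|S|$ and let $\tilde S$ be the corresponding sequence of $2$-sets. Then for every $\tau\in\mathcal{S}_n$, the instance $(n,m,\tilde S,\tau)$ (whose specification sets are the $m$ $2$-sets of $\tilde S$, in order) is a YES-instance of V2-WPPSG$_0[2]$. (2) Let $X=[a+1:a+n']$ be an integer subinterval of $[n]$, let $S$ be a universal sequence of adjacent transpositions on $X$ and $m=|S|$. Let $\tau_0\in\mathcal{S}_n$ and let $\tau_1,\ldots,\tau_m$ be the permutations chosen by the sorting strategy applied to $\tau_0$ and the $m$ $2$-sets of $\tilde S$. Then $\tau_m$ is the unique $X$-sorted permutation that coincides with $\tau_0$ outside $X$.
   Context: $[n]=\{1,\ldots,n\}$, $[a:b]=\{a,\ldots,b\}$; $\mathcal{S}_n$ is the symmetric group on $[n]$, composed left to right ($i(\sigma_1\sigma_2)=(i\sigma_1)\sigma_2$). $\langle i,j\rangle$ is the transposition of $i,j$, adjacent if $j=i\pm1$. A sequence of transpositions on an interval $Y$ is universal if every permutation of $Y$ (fixing everything outside $Y$) is the composition, in order, of the transpositions of some subsequence. For $S=\langle i_1,j_1\rangle,\ldots,\langle i_s,j_s\rangle$, $\tilde S=\{i_1,j_1\},\ldots,\{i_s,j_s\}$. For $X\subseteq[n]$, $\tau'\xrightarrow{X}\tau$ means $i\tau=i\tau'$ for all $i\notin X$; $\tau$ is $X$-sorted if $i\tau<j\tau$ whenever $i<j$ in $X$. V2-WPPSG: given $(n,m,X_1,\ldots,X_m,\tau_0)$,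 do there exist $\tau_1,\ldots,\tau_m\in\mathcal{S}_n$ with $\tau_m=\mathrm{id}$ and $\tau_{j-1}\xrightarrow{X_j}\tau_j$ for all $j$? V2-WPPSG$_0[2]$ is its restriction to instances where every $X_j$ is a set of two consecutive integers. The sorting strategy applied to $\tau_0$ and $X_1,\ldots,X_m$ sets $\tau_j$ to be the unique $X_j$-sorted permutation coinciding with $\tau_{j-1}$ outside $X_j$. -}

module Defs where

open import Data.Nat using (ℕ; suc; _+_; _≤_; _<_)
open import Data.Fin using (Fin; toℕ) renaming (_<_ to _<ᶠ_)
open import Data.Fin.Permutation using (Permutation′; _⟨$⟩ʳ_; _≈_; _∘ₚ_; id; transpose)
open import Data.List using (List; []; _∷_; map; foldr)
open import Data.List.Relation.Binary.Sublist.Propositional using (_⊆_)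
open import Data.List.Relation.Unary.All using (All)
open import Data.Product using (Σ; _×_; _,_; proj₁; proj₂; ∃)
open import Data.Sum using (_⊎_)
open import Relation.Nullary using (¬_)
open import Relation.Binary.PropositionalEquality using (_≡_)

-- Convention: the paper's [n] = {1,…,n} is represented by Fin n,
-- paper element k corresponding to the Fin element with toℕ = k - 1.
-- Permutations are elements of Permutation′ n; i τ is written τ ⟨$⟩ʳ i.
-- _∘ₚ_ composes left to right: (π₁ ∘ₚ π₂) ⟨$⟩ʳ i = π₂ ⟨$⟩ʳ (π₁ ⟨$⟩ʳ i).

SubsetP : ℕ → Set₁
SubsetP n = Fin n → Set

Transp : ℕ → Set
Transp n = Fin n × Fin n

toPerm : ∀ {n} → Transp n → Permutation′ n
toPerm (i , j) = transpose i j

Adjacent : ∀ {n} → Transp n → Set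
Adjacent (i , j) = suc (toℕ i) ≡ toℕ j ⊎ suc (toℕ j) ≡ toℕ i

TranspOn : ∀ {n} → SubsetP n → Transp n → Set
TranspOn Y (i , j) = Y i × Y j

composeSeq : ∀ {n} → List (Transp n) → Permutation′ n
composeSeq = foldr (λ t ρ → toPerm t ∘ₚ ρ) id

FixesOutside : ∀ {n} → SubsetP n → Permutation′ n → Set
FixesOutside Y π = ∀ i → ¬ Y i → π ⟨$⟩ʳ i ≡ i

Universal : ∀ {n} → SubsetP n → List (Transp n) → Set
Universal {n} Y S =
  (π : Permutation′ n) → FixesOutside Y π →
  Σ (List (Transp n)) λ T → T ⊆ S × π ≈ composeSeq T

twoSet : ∀ {n} → Transp n → SubsetP n
twoSet (i , j) k = k ≡ i ⊎ k ≡ j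

-- integer interval [a+1 : a+n'] of [n] (as Fin indices a, …, a+n'-1)
Interval : ∀ {n} → ℕ → ℕ → SubsetP n
Interval a n' k = a ≤ toℕ k × toℕ k < a + n'

Coincide : ∀ {n} → SubsetP n → Permutation′ n → Permutation′ n → Set
Coincide X τ' τ = ∀ i → ¬ X i → τ ⟨$⟩ʳ i ≡ τ' ⟨$⟩ʳ i

Sorted : ∀ {n} → SubsetP n → Permutation′ n → Set
Sorted X τ = ∀ i j → X i → X j → i <ᶠ j → (τ ⟨$⟩ʳ i) <ᶠ (τ ⟨$⟩ʳ j)

WPPSGYes : ∀ {n} → Permutation′ n → List (SubsetP n) → Set
WPPSGYes τ₀ [] = τ₀ ≈ id
WPPSGYes {n} τ₀ (X ∷ Xs) = Σ (Permutation′ n) λ τ₁ → Coincide X τ₀ τ₁ × WPPSGYes τ₁ Xs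

data SortRun {n} : Permutation′ n → List (SubsetP n) → Permutation′ n → Set₁ where
  done : ∀ {τ} → SortRun τ [] τ
  step : ∀ {τ₀ τ₁ τₘ X Xs} → Sorted X τ₁ → Coincide X τ₀ τ₁ →
         SortRun τ₁ Xs τₘ → SortRun τ₀ (X ∷ Xs) τₘ

-- Compare sequences of naturals by dominance: h ≼ g when, for every threshold y and every
-- prefix length k, h has at most as many entries ≥ y among its first k entries as g (the
-- tableau criterion for the Bruhat order, applied to one-line notations `values τ`).
-- A sorting step at adjacent positions only moves a large entry to the right, so it goes
-- down in ≼; and if h ≼ g, then sorting h at j and swapping g at j preserves h ≼ g.
-- By universality, every σ that agrees with τ₀ outside X is τ₀ followed by the
-- transpositions of a subsequence T of S. Running the sorting strategy along S while
-- applying exactly the transpositions of T to a copy of τ₀ thus gives τₘ ≼ σ. Choosing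
-- for σ the permutation τₘ with an adjacent pair of X swapped forces that pair to be in
-- order, so τₘ is X-sorted; the X-sorted permutation with prescribed values outside X is
-- unique by a first-difference argument. Part (1) is the same walk along S without
-- sorting: apply the transpositions of T and stand still at the others.

module Submission where

open import Defs
open import Data.Nat using (ℕ; zero; suc; _+_; _∸_; _≤_; _<_; _≤?_; _<?_; z≤n; s≤s)
open import Data.Nat.Properties
  using (≤-refl; ≤-trans; ≤-reflexive; <⇒≤; <-trans; <-irrefl; <-asym; ≤∧≢⇒<; 1+n≢n;
         m≤m+n; m≤n+m; n≤1+n; m∸n+n≡m; +-identityʳ; +-assoc; +-comm; +-suc;
         +-monoˡ-≤; +-monoʳ-≤; +-mono-≤; +-cancelˡ-≤; +-cancelʳ-≤; module ≤-Reasoning)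
  renaming (_≟_ to _≟ℕ_)
open import Data.Fin using (Fin; toℕ; fromℕ<; _≟_) renaming (_<_ to _<ᶠ_)
open import Data.Fin.Properties using (toℕ-injective; toℕ-fromℕ<; toℕ<n; <-cmp)
open import Data.Fin.Induction using (<-wellFounded)
open import Data.Fin.Permutation
  using (Permutation′; _⟨$⟩ʳ_; _⟨$⟩ˡ_; _≈_; _∘ₚ_; id; flip; transpose; inverseˡ; inverseʳ)
open import Data.List using (List; []; _∷_; map)
open import Data.List.Relation.Binary.Sublist.Propositional using (_⊆_; []; _∷_; _∷ʳ_)
open import Data.List.Relation.Unary.All using (All; []; _∷_)
open import Data.Product using (Σ; _×_; _,_; proj₁; proj₂)
open import Data.Sum using (_⊎_; inj₁; inj₂)
import Data.Sum as Sum
open import Data.Unit using (⊤; tt)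
open import Data.Empty using (⊥)
open import Function.Base using (_∘′_)
open import Function.Bundles using (Injection)
open import Function.Properties.Inverse using (↔⇒↣)
open import Induction.WellFounded using (Acc; acc)
open import Relation.Binary.Definitions using (tri<; tri≈; tri>)
open import Relation.Binary.PropositionalEquality
  using (_≡_; _≢_; _≗_; refl; sym; trans; cong; cong₂; subst; subst₂; module ≡-Reasoning)
open import Relation.Nullary using (¬_; Dec; yes; no; contradiction)
open import Relation.Nullary.Decidable using (_×-dec_; _⊎-dec_)
open import Relation.Unary using (Decidable)

private
  variable
    n a n′ j y v w : ℕ
    h h′ g g′ : ℕ → ℕ
    i k p q lo hi : Fin n
    τ τ₀ τ₁ τ₂ τₘ ρ σ π : Permutation′ n
    t : Transp n
    S T : List (Transp n)
    X Y : SubsetP n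

[_≤_] : ℕ → ℕ → ℕ
[ y ≤ v ] with y ≤? v
... | yes _ = 1
... | no _  = 0

[≤]≡1 : y ≤ v → [ y ≤ v ] ≡ 1
[≤]≡1 {y} {v} y≤v with y ≤? v
... | yes _   = refl
... | no y≰v = contradiction y≤v y≰v

[≤]≡0 : ¬ y ≤ v → [ y ≤ v ] ≡ 0
[≤]≡0 {y} {v} y≰v with y ≤? v
... | yes y≤v = contradiction y≤v y≰v
... | no _    = refl

[≤]≤1 : ∀ y v → [ y ≤ v ] ≤ 1
[≤]≤1 y v with y ≤? v
... | yes _ = ≤-refl
... | no _  = z≤n

[≤]-monoʳ : ∀ y → v ≤ w → [ y ≤ v ] ≤ [ y ≤ w ]
[≤]-monoʳ {v} y v≤w with y ≤? v
... | yes y≤v = ≤-reflexive (sym ([≤]≡1 (≤-trans y≤v v≤w)))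
... | no _    = z≤n

count : ℕ → (ℕ → ℕ) → ℕ → ℕ
count y h zero    = 0
count y h (suc k) = count y h k + [ y ≤ h k ]

count-cong : h ≗ g → ∀ y k → count y h k ≡ count y g k
count-cong h≗g y zero    = refl
count-cong h≗g y (suc k) = cong₂ _+_ (count-cong h≗g y k) (cong [ y ≤_] (h≗g k))

infix 4 _≼_

_≼_ : (ℕ → ℕ) → (ℕ → ℕ) → Set
h ≼ g = ∀ y k → count y h k ≤ count y g k

≼-refl : h ≼ h
≼-refl y k = ≤-refl

≼-trans : h ≼ h′ → h′ ≼ g → h ≼ g
≼-trans h≼h′ h′≼g y k = ≤-trans (h≼h′ y k) (h′≼g y k)

≼-respʳ : g ≗ g′ → h ≼ g → h ≼ g′
≼-respʳ g≗g′ h≼g y k = ≤-trans (h≼g y k) (≤-reflexive (count-cong g≗g′ y k))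

SwapAt : ℕ → (ℕ → ℕ) → (ℕ → ℕ) → Set
SwapAt j h g = (∀ x → x ≢ j → x ≢ suc j → g x ≡ h x) × g j ≡ h (suc j) × g (suc j) ≡ h j

SortAt : ℕ → (ℕ → ℕ) → (ℕ → ℕ) → Set
SortAt j h h′ = (h′ ≗ h ⊎ SwapAt j h h′) × h′ j ≤ h′ (suc j)

n≢1+n : ∀ n → n ≢ suc n
n≢1+n n = 1+n≢n ∘′ sym

count-SwapAt : SwapAt j h g → ∀ y k → k ≢ suc j → count y g k ≡ count y h k
count-SwapAt sw y zero _ = refl
count-SwapAt {j} {h} {g} sw@(off , gj , gj+1) y (suc k) 1+k≢1+j with k ≟ℕ j | k ≟ℕ suc j
... | yes refl | _        = contradiction refl 1+k≢1+j
... | no k≢j   | no k≢1+j = cong₂ _+_ (count-SwapAt sw y k k≢1+j) (cong [ y ≤_] (off k k≢j k≢1+j))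
... | no _     | yes refl = begin
  count y g j + [ y ≤ g j ] + [ y ≤ g (suc j) ]   ≡⟨ +-assoc (count y g j) _ _ ⟩
  count y g j + ([ y ≤ g j ] + [ y ≤ g (suc j) ])
    ≡⟨ cong₂ _+_ (count-SwapAt sw y j (n≢1+n j)) pair ⟩
  count y h j + ([ y ≤ h j ] + [ y ≤ h (suc j) ]) ≡⟨ +-assoc (count y h j) _ _ ⟨
  count y h j + [ y ≤ h j ] + [ y ≤ h (suc j) ]   ∎
  where
  open ≡-Reasoning
  pair : [ y ≤ g j ] + [ y ≤ g (suc j) ] ≡ [ y ≤ h j ] + [ y ≤ h (suc j) ]
  pair = trans (cong₂ _+_ (cong [ y ≤_] gj) (cong [ y ≤_] gj+1))
               (+-comm [ y ≤ h (suc j) ] [ y ≤ h j ])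

count-SortAt : SortAt j h h′ → ∀ y k → k ≢ suc j → count y h′ k ≡ count y h k
count-SortAt (inj₁ h′≗h , _) y k _ = count-cong h′≗h y k
count-SortAt (inj₂ sw , _)        = count-SwapAt sw

SortAt-≼ : SortAt j h h′ → h′ ≼ h
SortAt-≼ (inj₁ h′≗h , _) y k = ≤-reflexive (count-cong h′≗h y k)
SortAt-≼ {j} (inj₂ sw@(_ , _ , h′j+1) , ordered) y k with k ≟ℕ suc j
... | no k≢1+j = ≤-reflexive (count-SwapAt sw y k k≢1+j)
... | yes refl = +-mono-≤ (≤-reflexive (count-SwapAt sw y j (n≢1+n j)))
                          ([≤]-monoʳ y (≤-trans ordered (≤-reflexive h′j+1)))

SortAt-both-≥ : SortAt j h h′ → y ≤ h′ j → y ≤ h j × y ≤ h (suc j)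
SortAt-both-≥ {j} (inj₁ h′≗h , ordered) y≤ =
  ≤-trans y≤ (≤-reflexive (h′≗h j)) , ≤-trans y≤ (≤-trans ordered (≤-reflexive (h′≗h (suc j))))
SortAt-both-≥ (inj₂ (_ , h′j , h′j+1) , ordered) y≤ =
  ≤-trans y≤ (≤-trans ordered (≤-reflexive h′j+1)) , ≤-trans y≤ (≤-reflexive h′j)

m+1+1≤n+u+w⇒m+1≤n+w : ∀ m n u w → u ≤ 1 → m + 1 + 1 ≤ n + u + w → m + 1 ≤ n + w
m+1+1≤n+u+w⇒m+1≤n+w m n u w u≤1 le = +-cancelʳ-≤ 1 (m + 1) (n + w) (begin
  m + 1 + 1 ≤⟨ le ⟩
  n + u + w ≤⟨ +-monoˡ-≤ w (+-monoʳ-≤ n u≤1) ⟩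
  n + 1 + w ≡⟨ trans (+-assoc n 1 w) (trans (cong (n +_) (+-comm 1 w)) (sym (+-assoc n w 1))) ⟩
  n + w + 1 ∎)
  where open ≤-Reasoning

SortAt-SwapAt-≼-pivot : SortAt j h h′ → SwapAt j g g′ → h ≼ g →
                        ∀ y → count y h′ (suc j) ≤ count y g′ (suc j)
SortAt-SwapAt-≼-pivot {j} {h} {h′} {g} {g′} srt sw h≼g y = begin
  count y h′ j + [ y ≤ h′ j ]     ≡⟨ cong (_+ [ y ≤ h′ j ]) (count-SortAt srt y j (n≢1+n j)) ⟩
  count y h j + [ y ≤ h′ j ]      ≤⟨ by-threshold (y ≤? h′ j) ⟩
  count y g j + [ y ≤ g (suc j) ] ≡⟨ cong₂ _+_ (count-SwapAt sw y j (n≢1+n j))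
                                              (cong [ y ≤_] (proj₁ (proj₂ sw))) ⟨
  count y g′ j + [ y ≤ g′ j ]     ∎
  where
  open ≤-Reasoning
  by-threshold : Dec (y ≤ h′ j) → count y h j + [ y ≤ h′ j ] ≤ count y g j + [ y ≤ g (suc j) ]
  by-threshold (no y≰) = begin
    count y h j + [ y ≤ h′ j ] ≡⟨ trans (cong (count y h j +_) ([≤]≡0 y≰)) (+-identityʳ _) ⟩
    count y h j                ≤⟨ h≼g y j ⟩
    count y g j                ≤⟨ m≤m+n _ _ ⟩
    count y g j + [ y ≤ g (suc j) ] ∎
  by-threshold (yes y≤) = begin
    count y h j + [ y ≤ h′ j ] ≡⟨ cong (count y h j +_) ([≤]≡1 y≤) ⟩
    count y h j + 1            ≤⟨ m+1+1≤n+u+w⇒m+1≤n+w _ (count y g j) [ y ≤ g j ] _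
                                                        ([≤]≤1 y (g j)) two-more ⟩
    count y g j + [ y ≤ g (suc j) ] ∎
    where
    both = SortAt-both-≥ srt y≤
    two-more : count y h j + 1 + 1 ≤ count y g j + [ y ≤ g j ] + [ y ≤ g (suc j) ]
    two-more = subst (_≤ count y g j + [ y ≤ g j ] + [ y ≤ g (suc j) ])
                     (cong₂ (λ u w → count y h j + u + w) ([≤]≡1 (proj₁ both)) ([≤]≡1 (proj₂ both)))
                     (h≼g y (suc (suc j)))

SortAt-SwapAt-≼ : SortAt j h h′ → SwapAt j g g′ → h ≼ g → h′ ≼ g′
SortAt-SwapAt-≼ {j} {h} {h′} {g} {g′} srt sw h≼g y k with k ≟ℕ suc j
... | yes refl = SortAt-SwapAt-≼-pivot srt sw h≼g y
... | no k≢1+j = begin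
  count y h′ k ≡⟨ count-SortAt srt y k k≢1+j ⟩
  count y h k  ≤⟨ h≼g y k ⟩
  count y g k  ≡⟨ count-SwapAt sw y k k≢1+j ⟨
  count y g′ k ∎
  where open ≤-Reasoning

SwapAt-≼⇒ordered : SwapAt j h g → h ≼ g → h j ≤ h (suc j)
SwapAt-≼⇒ordered {j} {h} sw h≼g with h j ≤? h (suc j)
... | yes ordered = ordered
... | no unordered = contradiction (+-cancelˡ-≤ (count (h j) h j) 1 0 one≤zero) λ ()
  where
  one≤zero : count (h j) h j + 1 ≤ count (h j) h j + 0
  one≤zero = subst₂ _≤_
    (cong (count (h j) h j +_) ([≤]≡1 ≤-refl))
    (cong₂ _+_ (count-SwapAt sw (h j) j (n≢1+n j))
               (trans (cong [ h j ≤_] (proj₁ (proj₂ sw))) ([≤]≡0 unordered)))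
    (h≼g (h j) (suc j))

perm-injective : (π : Permutation′ n) → π ⟨$⟩ʳ i ≡ π ⟨$⟩ʳ k → i ≡ k
perm-injective π = Injection.injective (↔⇒↣ π)

Coincide-sym : Coincide X τ σ → Coincide X σ τ
Coincide-sym c i i∉X = sym (c i i∉X)

Coincide-trans : Coincide X τ₀ τ₁ → Coincide X τ₁ τ₂ → Coincide X τ₀ τ₂
Coincide-trans c₀₁ c₁₂ i i∉X = trans (c₁₂ i i∉X) (c₀₁ i i∉X)

Coincide-mono : (∀ {i} → Y i → X i) → Coincide Y τ σ → Coincide X τ σ
Coincide-mono Y⊆X c i i∉X = c i (i∉X ∘′ Y⊆X)

Swaps : Fin n → Fin n → Permutation′ n → Set
Swaps i k π = π ⟨$⟩ʳ i ≡ k × π ⟨$⟩ʳ k ≡ i × (∀ l → l ≢ i → l ≢ k → π ⟨$⟩ʳ l ≡ l)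

Swaps-sym : Swaps i k π → Swaps k i π
Swaps-sym (πi , πk , fix) = πk , πi , λ l l≢k l≢i → fix l l≢i l≢k

Swaps-involutive : Swaps i k π → ∀ l → π ⟨$⟩ʳ (π ⟨$⟩ʳ l) ≡ l
Swaps-involutive {i = i} {k = k} {π = π} (πi , πk , fix) l with l ≟ i | l ≟ k
... | yes refl | _        = trans (cong (π ⟨$⟩ʳ_) πi) πk
... | no _     | yes refl = trans (cong (π ⟨$⟩ʳ_) πk) πi
... | no l≢i   | no l≢k   = trans (cong (π ⟨$⟩ʳ_) (fix l l≢i l≢k)) (fix l l≢i l≢k)

transpose-swaps : (i k : Fin n) → Swaps i k (transpose i k)
transpose-swaps i k = at-i , at-k , elsewhere
  where
  at-i : transpose i k ⟨$⟩ʳ i ≡ k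
  at-i with i ≟ i
  ... | yes _   = refl
  ... | no i≢i = contradiction refl i≢i
  at-k : transpose i k ⟨$⟩ʳ k ≡ i
  at-k with k ≟ i
  ... | yes refl = refl
  ... | no _ with k ≟ k
  ...   | yes _   = refl
  ...   | no k≢k = contradiction refl k≢k
  elsewhere : ∀ l → l ≢ i → l ≢ k → transpose i k ⟨$⟩ʳ l ≡ l
  elsewhere l l≢i l≢k with l ≟ i
  ... | yes l≡i = contradiction l≡i l≢i
  ... | no _ with l ≟ k
  ...   | yes l≡k = contradiction l≡k l≢k
  ...   | no _    = refl

toPerm-swaps : (t : Transp n) → Swaps (proj₁ t) (proj₂ t) (toPerm t)
toPerm-swaps (i , k) = transpose-swaps i k

toPerm-fixes : (t : Transp n) → ¬ twoSet t i → toPerm t ⟨$⟩ʳ i ≡ i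
toPerm-fixes t i∉t = proj₂ (proj₂ (toPerm-swaps t)) _ (i∉t ∘′ inj₁) (i∉t ∘′ inj₂)

Coincide-toPerm : (t : Transp n) → Coincide (twoSet t) τ (toPerm t ∘ₚ τ)
Coincide-toPerm {τ = τ} t i i∉t = cong (τ ⟨$⟩ʳ_) (toPerm-fixes t i∉t)

twoSet? : (t : Transp n) → Decidable (twoSet t)
twoSet? (i , k) l = (l ≟ i) ⊎-dec (l ≟ k)

Coincide-twoSet-image : (t : Transp n) → Coincide (twoSet t) τ₀ τ₁ → twoSet t i →
                        τ₁ ⟨$⟩ʳ i ≡ τ₀ ⟨$⟩ʳ proj₁ t ⊎ τ₁ ⟨$⟩ʳ i ≡ τ₀ ⟨$⟩ʳ proj₂ t
Coincide-twoSet-image {τ₀ = τ₀} {τ₁ = τ₁} {i = i} t c i∈t with twoSet? t (τ₀ ⟨$⟩ˡ (τ₁ ⟨$⟩ʳ i))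
... | yes q∈t = Sum.map (via-preimage ∘′ cong (τ₀ ⟨$⟩ʳ_)) (via-preimage ∘′ cong (τ₀ ⟨$⟩ʳ_)) q∈t
  where
  via-preimage : ∀ {v} → τ₀ ⟨$⟩ʳ (τ₀ ⟨$⟩ˡ (τ₁ ⟨$⟩ʳ i)) ≡ v → τ₁ ⟨$⟩ʳ i ≡ v
  via-preimage = trans (sym (inverseʳ τ₀))
... | no q∉t = contradiction (subst (twoSet t) (sym q≡i) i∈t) q∉t
  where
  q≡i = perm-injective τ₁ (trans (c _ q∉t) (inverseʳ τ₀))

Coincide-twoSet-agree : (t : Transp n) → Coincide (twoSet t) ρ τ →
                        τ ⟨$⟩ʳ proj₁ t ≡ ρ ⟨$⟩ʳ proj₁ t → τ ⟨$⟩ʳ proj₂ t ≡ ρ ⟨$⟩ʳ proj₂ t → τ ≈ ρ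
Coincide-twoSet-agree t c at₁ at₂ l with twoSet? t l
... | yes (inj₁ refl) = at₁
... | yes (inj₂ refl) = at₂
... | no l∉t         = c l l∉t

Coincide-twoSet : (t : Transp n) → Coincide (twoSet t) τ₀ τ₁ → τ₁ ≈ τ₀ ⊎ τ₁ ≈ toPerm t ∘ₚ τ₀
Coincide-twoSet {τ₀ = τ₀} {τ₁ = τ₁} t@(i , k) c
  with Coincide-twoSet-image {τ₀ = τ₀} {τ₁ = τ₁} {i = i} t c (inj₁ refl)
     | Coincide-twoSet-image {τ₀ = τ₀} {τ₁ = τ₁} {i = k} t c (inj₂ refl)
... | inj₁ τ₁i | inj₂ τ₁k = inj₁ (Coincide-twoSet-agree {ρ = τ₀} {τ = τ₁} t c τ₁i τ₁k)
... | inj₂ τ₁i | inj₁ τ₁k = inj₂ (Coincide-twoSet-agree {ρ = toPerm t ∘ₚ τ₀} {τ = τ₁} t swapped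
                                  (trans τ₁i (cong (τ₀ ⟨$⟩ʳ_) (sym ti≡k)))
                                  (trans τ₁k (cong (τ₀ ⟨$⟩ʳ_) (sym tk≡i))))
  where
  ti≡k = proj₁ (transpose-swaps i k)
  tk≡i = proj₁ (proj₂ (transpose-swaps i k))
  swapped : Coincide (twoSet t) (toPerm t ∘ₚ τ₀) τ₁
  swapped l l∉t = trans (c l l∉t) (sym (Coincide-toPerm {τ = τ₀} t l l∉t))
... | inj₁ τ₁i | inj₁ τ₁k with perm-injective τ₁ (trans τ₁i (sym τ₁k))
...   | refl = inj₁ (Coincide-twoSet-agree {ρ = τ₀} {τ = τ₁} t c τ₁i τ₁i)
Coincide-twoSet {τ₀ = τ₀} {τ₁ = τ₁} t c | inj₂ τ₁i | inj₂ τ₁k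
  with perm-injective τ₁ (trans τ₁i (sym τ₁k))
...   | refl = inj₁ (Coincide-twoSet-agree {ρ = τ₀} {τ = τ₁} t c τ₁k τ₁k)

values : Permutation′ n → ℕ → ℕ
values {n} τ x with x <? n
... | yes x<n = toℕ (τ ⟨$⟩ʳ fromℕ< x<n)
... | no _    = 0

values-agree : ∀ x → (∀ i → toℕ i ≡ x → τ ⟨$⟩ʳ i ≡ ρ ⟨$⟩ʳ i) → values τ x ≡ values ρ x
values-agree {n} x agree with x <? n
... | yes x<n = cong toℕ (agree (fromℕ< x<n) (toℕ-fromℕ< x<n))
... | no _    = refl

values-cong : τ ≈ ρ → values τ ≗ values ρ
values-cong τ≈ρ x = values-agree x λ i _ → τ≈ρ i

values-at : (τ : Permutation′ n) (i : Fin n) → values τ (toℕ i) ≡ toℕ (τ ⟨$⟩ʳ i)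
values-at {n} τ i with toℕ i <? n
... | yes i<n = cong (λ l → toℕ (τ ⟨$⟩ʳ l)) (toℕ-injective (toℕ-fromℕ< i<n))
... | no i≮n  = contradiction (toℕ<n i) i≮n

values-swap : suc (toℕ lo) ≡ toℕ hi → Swaps lo hi π → τ ≈ π ∘ₚ ρ →
              SwapAt (toℕ lo) (values ρ) (values τ)
values-swap {lo = lo} {hi} {π} {τ} {ρ} adj (πlo , πhi , fix) τ≈ = off , at-lo , at-hi
  where
  off : ∀ x → x ≢ toℕ lo → x ≢ suc (toℕ lo) → values τ x ≡ values ρ x
  off x x≢lo x≢hi = values-agree x λ i i≡x →
    trans (τ≈ i) (cong (ρ ⟨$⟩ʳ_) (fix i (λ { refl → x≢lo (sym i≡x) })
                                        (λ { refl → x≢hi (trans (sym i≡x) (sym adj)) })))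
  at-lo : values τ (toℕ lo) ≡ values ρ (suc (toℕ lo))
  at-lo = begin
    values τ (toℕ lo)        ≡⟨ values-at τ lo ⟩
    toℕ (τ ⟨$⟩ʳ lo)          ≡⟨ cong toℕ (trans (τ≈ lo) (cong (ρ ⟨$⟩ʳ_) πlo)) ⟩
    toℕ (ρ ⟨$⟩ʳ hi)          ≡⟨ values-at ρ hi ⟨
    values ρ (toℕ hi)        ≡⟨ cong (values ρ) adj ⟨
    values ρ (suc (toℕ lo))  ∎
    where open ≡-Reasoning
  at-hi : values τ (suc (toℕ lo)) ≡ values ρ (toℕ lo)
  at-hi = begin
    values τ (suc (toℕ lo))  ≡⟨ cong (values τ) adj ⟩
    values τ (toℕ hi)        ≡⟨ values-at τ hi ⟩
    toℕ (τ ⟨$⟩ʳ hi)          ≡⟨ cong toℕ (trans (τ≈ hi) (cong (ρ ⟨$⟩ʳ_) πhi)) ⟩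
    toℕ (ρ ⟨$⟩ʳ lo)          ≡⟨ values-at ρ lo ⟨
    values ρ (toℕ lo)        ∎
    where open ≡-Reasoning

record Oriented (t : Transp n) : Set where
  field
    lower upper    : Fin n
    1+lower≡upper  : suc (toℕ lower) ≡ toℕ upper
    swaps          : Swaps lower upper (toPerm t)
    lower∈ : twoSet t lower
    upper∈ : twoSet t upper

orient : (t : Transp n) → Adjacent t → Oriented t
orient (i , k) (inj₁ 1+i≡k) = record
  { lower = i ; upper = k ; 1+lower≡upper = 1+i≡k
  ; swaps = transpose-swaps i k ; lower∈ = inj₁ refl ; upper∈ = inj₂ refl }
orient (i , k) (inj₂ 1+k≡i) = record
  { lower = k ; upper = i ; 1+lower≡upper = 1+k≡i
  ; swaps = Swaps-sym {π = transpose i k} (transpose-swaps i k)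
  ; lower∈ = inj₂ refl ; upper∈ = inj₁ refl }

position : (t : Transp n) → Adjacent t → ℕ
position t adj = toℕ (Oriented.lower (orient t adj))

values-toPerm : (t : Transp n) (adj : Adjacent t) → τ ≈ toPerm t ∘ₚ ρ →
                SwapAt (position t adj) (values ρ) (values τ)
values-toPerm {τ = τ} {ρ = ρ} t adj =
  values-swap {lo = lower} {hi = upper} {π = toPerm t} {τ = τ} {ρ = ρ} 1+lower≡upper swaps
  where open Oriented (orient t adj)

sortStep-SortAt : (t : Transp n) (adj : Adjacent t) →
                  Sorted (twoSet t) τ₁ → Coincide (twoSet t) τ₀ τ₁ →
                  SortAt (position t adj) (values τ₀) (values τ₁)
sortStep-SortAt {τ₁ = τ₁} {τ₀ = τ₀} t adj τ₁-sorted c =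
  Sum.map (values-cong {τ = τ₁} {ρ = τ₀}) (values-toPerm t adj)
          (Coincide-twoSet {τ₀ = τ₀} {τ₁ = τ₁} t c)
  , ordered
  where
  open Oriented (orient t adj)
  ordered : values τ₁ (toℕ lower) ≤ values τ₁ (suc (toℕ lower))
  ordered = subst₂ _≤_ (sym (values-at τ₁ lower))
                       (sym (trans (cong (values τ₁) 1+lower≡upper) (values-at τ₁ upper)))
                       (<⇒≤ (τ₁-sorted lower upper lower∈ upper∈ (≤-reflexive 1+lower≡upper)))

Coincide⇒decomposition : Universal X S → Coincide X τ₀ σ →
                         Σ (List (Transp n)) λ T → T ⊆ S × τ₀ ≈ composeSeq T ∘ₚ σ
Coincide⇒decomposition {X = X} {τ₀ = τ₀} {σ = σ} universal c
  with universal (τ₀ ∘ₚ flip σ) fixes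
  where
  fixes : FixesOutside X (τ₀ ∘ₚ flip σ)
  fixes i i∉X = trans (cong (σ ⟨$⟩ˡ_) (sym (c i i∉X))) (inverseˡ σ)
... | T , T⊆S , τ₀σ⁻¹≈T = T , T⊆S , λ i → trans (sym (inverseʳ σ)) (cong (σ ⟨$⟩ʳ_) (τ₀σ⁻¹≈T i))

decomposition-step : (t : Transp n) → ρ ≈ composeSeq (t ∷ T) ∘ₚ σ →
                     toPerm t ∘ₚ ρ ≈ composeSeq T ∘ₚ σ
decomposition-step {T = T} {σ = σ} t ρ≈ i =
  trans (ρ≈ (toPerm t ⟨$⟩ʳ i))
        (cong (λ l → σ ⟨$⟩ʳ (composeSeq T ⟨$⟩ʳ l))
              (Swaps-involutive {π = toPerm t} (toPerm-swaps t) i))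

decomposition⇒WPPSGYes : T ⊆ S → τ ≈ composeSeq T ∘ₚ id → WPPSGYes τ (map twoSet S)
decomposition⇒WPPSGYes []                 τ≈ = τ≈
decomposition⇒WPPSGYes {τ = τ} (t ∷ʳ T⊆S) τ≈ = τ , (λ _ _ → refl) , decomposition⇒WPPSGYes T⊆S τ≈
decomposition⇒WPPSGYes {T = t ∷ T} {τ = τ} (refl ∷ T⊆S) τ≈ =
  toPerm t ∘ₚ τ , Coincide-toPerm {τ = τ} t ,
  decomposition⇒WPPSGYes T⊆S (decomposition-step {ρ = τ} {T = T} {σ = id} t τ≈)

universal⇒WPPSGYes : Universal (λ _ → ⊤) S → ∀ τ → WPPSGYes τ (map twoSet S)
universal⇒WPPSGYes universal τ
  with Coincide⇒decomposition {τ₀ = τ} {σ = id} universal (λ _ ∉⊤ → contradiction tt ∉⊤)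
... | T , T⊆S , τ≈ = decomposition⇒WPPSGYes T⊆S τ≈

sortRun-≼ : All Adjacent S → SortRun τ (map twoSet S) τₘ → T ⊆ S → ρ ≈ composeSeq T ∘ₚ σ →
            values τ ≼ values ρ → values τₘ ≼ values σ
sortRun-≼ {ρ = ρ} {σ = σ} [] done [] ρ≈σ τ≼ρ = ≼-respʳ (values-cong {τ = ρ} {ρ = σ} ρ≈σ) τ≼ρ
sortRun-≼ {S = t ∷ S} {τ = τ} (adj ∷ adjs) (step {τ₁ = τ₁} sorted c run) (.t ∷ʳ T⊆S) ρ≈ τ≼ρ =
  sortRun-≼ adjs run T⊆S ρ≈
    (≼-trans (SortAt-≼ (sortStep-SortAt {τ₁ = τ₁} {τ₀ = τ} t adj sorted c)) τ≼ρ)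
sortRun-≼ {S = t ∷ S} {τ = τ} {T = .t ∷ T} {ρ = ρ} {σ = σ}
          (adj ∷ adjs) (step {τ₁ = τ₁} sorted c run) (refl ∷ T⊆S) ρ≈ τ≼ρ =
  sortRun-≼ adjs run T⊆S (decomposition-step {ρ = ρ} {T = T} {σ = σ} t ρ≈)
    (SortAt-SwapAt-≼ (sortStep-SortAt {τ₁ = τ₁} {τ₀ = τ} t adj sorted c)
                     (values-toPerm {τ = toPerm t ∘ₚ ρ} {ρ = ρ} t adj (λ _ → refl)) τ≼ρ)

TranspOn⇒twoSet⊆ : TranspOn X t → twoSet t i → X i
TranspOn⇒twoSet⊆ (Xi , _)  (inj₁ refl) = Xi
TranspOn⇒twoSet⊆ (_ , Xk)  (inj₂ refl) = Xk

sortRun-coincide : All (TranspOn X) S → SortRun τ₀ (map twoSet S) τₘ → Coincide X τ₀ τₘ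
sortRun-coincide [] done = λ _ _ → refl
sortRun-coincide {τ₀ = τ₀} {τₘ = τₘ} (on ∷ ons) (step {τ₁ = τ₁} _ c run) =
  Coincide-trans {τ₀ = τ₀} {τ₁ = τ₁} {τ₂ = τₘ}
    (Coincide-mono {τ = τ₀} {σ = τ₁} (TranspOn⇒twoSet⊆ on) c) (sortRun-coincide ons run)

sortRun-≼-coinciding : All Adjacent S → Universal X S → SortRun τ₀ (map twoSet S) τₘ →
                       Coincide X τ₀ σ → values τₘ ≼ values σ
sortRun-≼-coinciding {τ₀ = τ₀} {σ = σ} adjs universal run c
  with Coincide⇒decomposition {τ₀ = τ₀} {σ = σ} universal c
... | T , T⊆S , τ₀≈ = sortRun-≼ adjs run T⊆S τ₀≈ ≼-refl

≼-minimal⇒ordered : (∀ σ → Coincide X τ σ → values τ ≼ values σ) →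
                    X p → X q → suc (toℕ p) ≡ toℕ q → τ ⟨$⟩ʳ p <ᶠ τ ⟨$⟩ʳ q
≼-minimal⇒ordered {X = X} {τ = τ} {p = p} {q = q} minimal Xp Xq adj =
  ≤∧≢⇒< (subst₂ _≤_ (values-at τ p) (trans (cong (values τ) adj) (values-at τ q)) ordered) distinct
  where
  τ′ = transpose p q ∘ₚ τ
  swapped : SwapAt (toℕ p) (values τ) (values τ′)
  swapped = values-swap {π = transpose p q} {τ = τ′} {ρ = τ} adj (transpose-swaps p q) (λ _ → refl)
  ordered : values τ (toℕ p) ≤ values τ (suc (toℕ p))
  ordered = SwapAt-≼⇒ordered swapped
    (minimal τ′ (Coincide-mono {τ = τ} {σ = τ′} (TranspOn⇒twoSet⊆ (Xp , Xq))
                                                 (Coincide-toPerm {τ = τ} (p , q))))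
  distinct : toℕ (τ ⟨$⟩ʳ p) ≢ toℕ (τ ⟨$⟩ʳ q)
  distinct τp≡τq = 1+n≢n (trans adj (cong toℕ (sym (perm-injective τ (toℕ-injective τp≡τq)))))

Interval-sorted : (∀ {p q} → Interval a n′ p → Interval a n′ q → suc (toℕ p) ≡ toℕ q →
                             τ ⟨$⟩ʳ p <ᶠ τ ⟨$⟩ʳ q) →
                  Sorted (Interval a n′) τ
Interval-sorted {a = a} {n′ = n′} {τ = τ} ordered i k Xi Xk i<k =
  chain (toℕ k ∸ suc (toℕ i)) Xi Xk (sym (trans (sym (+-suc _ (toℕ i))) (m∸n+n≡m i<k)))
  where
  chain : ∀ d {i k} → Interval a n′ i → Interval a n′ k → toℕ k ≡ suc (d + toℕ i) →
          τ ⟨$⟩ʳ i <ᶠ τ ⟨$⟩ʳ k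
  chain zero    Xi Xk k≡ = ordered Xi Xk (sym k≡)
  chain (suc d) {i} {k} Xi Xk k≡ = <-trans (ordered Xi Xl (sym (toℕ-fromℕ< l<n))) (chain d Xl Xk l≡)
    where
    l<k : suc (toℕ i) < toℕ k
    l<k = ≤-trans (s≤s (s≤s (m≤n+m (toℕ i) d))) (≤-reflexive (sym k≡))
    l<n = <-trans l<k (toℕ<n k)
    l = fromℕ< l<n
    Xl : Interval a n′ l
    Xl = subst (a ≤_) (sym (toℕ-fromℕ< l<n)) (≤-trans (proj₁ Xi) (n≤1+n _))
       , subst (_< a + n′) (sym (toℕ-fromℕ< l<n)) (<-trans l<k (proj₂ Xk))
    l≡ : toℕ k ≡ suc (d + toℕ l)
    l≡ = trans k≡ (cong suc (trans (sym (+-suc d (toℕ i))) (cong (d +_) (sym (toℕ-fromℕ< l<n)))))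

sorted-¬< : Decidable X → Sorted X ρ → Coincide X σ ρ → X i →
            (∀ {l} → l <ᶠ i → σ ⟨$⟩ʳ l ≡ ρ ⟨$⟩ʳ l) → ¬ (σ ⟨$⟩ʳ i <ᶠ ρ ⟨$⟩ʳ i)
sorted-¬< {X = X} {ρ = ρ} {σ = σ} {i = i} X? ρ-sorted c Xi agree-below σi<ρi = preimage (inverseʳ ρ)
  where
  preimage : ∀ {l} → ρ ⟨$⟩ʳ l ≡ σ ⟨$⟩ʳ i → ⊥
  preimage {l} ρl≡σi with X? l
  ... | no l∉X = l∉X (subst X (sym (perm-injective σ (trans (sym (c l l∉X)) ρl≡σi))) Xi)
  ... | yes Xl with <-cmp l i
  ...   | tri< l<i _ _  = <-irrefl (cong toℕ (perm-injective σ (trans (agree-below l<i) ρl≡σi))) l<i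
  ...   | tri≈ _ refl _ = <-irrefl (cong toℕ (sym ρl≡σi)) σi<ρi
  ...   | tri> _ _ i<l  = <-asym σi<ρi (subst (ρ ⟨$⟩ʳ i <ᶠ_) ρl≡σi (ρ-sorted i l Xi Xl i<l))

sorted-unique : Decidable X → Sorted X σ → Sorted X ρ → Coincide X τ₀ σ → Coincide X τ₀ ρ → σ ≈ ρ
sorted-unique {X = X} {σ = σ} {ρ = ρ} {τ₀ = τ₀} X? σ-sorted ρ-sorted cσ cρ i =
  agree (<-wellFounded i)
  where
  cσρ : Coincide X σ ρ
  cσρ = Coincide-trans {τ₀ = σ} {τ₁ = τ₀} {τ₂ = ρ} (Coincide-sym {τ = τ₀} {σ = σ} cσ) cρ
  agree : ∀ {i} → Acc _<ᶠ_ i → σ ⟨$⟩ʳ i ≡ ρ ⟨$⟩ʳ i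
  agree {i} (acc below) with X? i
  ... | no i∉X = sym (cσρ i i∉X)
  ... | yes Xi with <-cmp (σ ⟨$⟩ʳ i) (ρ ⟨$⟩ʳ i)
  ...   | tri≈ _ σi≡ρi _ = σi≡ρi
  ...   | tri< σi<ρi _ _ =
          contradiction σi<ρi (sorted-¬< {ρ = ρ} {σ = σ} X? ρ-sorted cσρ Xi
                                         λ l<i → agree (below l<i))
  ...   | tri> _ _ ρi<σi =
          contradiction ρi<σi (sorted-¬< {ρ = σ} {σ = ρ} X? σ-sorted
                                         (Coincide-sym {τ = σ} {σ = ρ} cσρ) Xi
                                         λ l<i → sym (agree (below l<i)))

Interval? : ∀ a n′ → Decidable (Interval {n} a n′)
Interval? a n′ k = (a ≤? toℕ k) ×-dec (toℕ k <? a + n′)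

sortRun-sorted : All Adjacent S → All (TranspOn (Interval a n′)) S → Universal (Interval a n′) S →
                 SortRun τ₀ (map twoSet S) τₘ → Sorted (Interval a n′) τₘ
sortRun-sorted {a = a} {n′ = n′} {τ₀ = τ₀} {τₘ = τₘ} adjs ons universal run =
  Interval-sorted {τ = τₘ} (≼-minimal⇒ordered {τ = τₘ} minimal)
  where
  minimal : ∀ σ → Coincide (Interval a n′) τₘ σ → values τₘ ≼ values σ
  minimal σ c = sortRun-≼-coinciding {σ = σ} adjs universal run
    (Coincide-trans {τ₀ = τ₀} {τ₁ = τₘ} {τ₂ = σ} (sortRun-coincide ons run) c)

corollary3p9 :
    (∀ (n : ℕ) (S : List (Transp n)) → All Adjacent S → Universal (λ _ → ⊤) S →
       ∀ (τ : Permutation′ n) → WPPSGYes τ (map twoSet S))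
    ×
    (∀ (n a n' : ℕ) → a + n' ≤ n →
       ∀ (S : List (Transp n)) → All Adjacent S → All (TranspOn (Interval a n')) S →
       Universal (Interval a n') S →
       ∀ (τ₀ τₘ : Permutation′ n) → SortRun τ₀ (map twoSet S) τₘ →
       Sorted (Interval a n') τₘ × Coincide (Interval a n') τ₀ τₘ ×
       (∀ (σ : Permutation′ n) → Sorted (Interval a n') σ → Coincide (Interval a n') τ₀ σ → σ ≈ τₘ))
corollary3p9 =
  (λ n S _ → universal⇒WPPSGYes {S = S}) ,
  λ n a n′ _ S adjs ons universal τ₀ τₘ run →
    let τₘ-sorted    = sortRun-sorted {τ₀ = τ₀} adjs ons universal run
        τₘ-coincides = sortRun-coincide {τ₀ = τ₀} {τₘ = τₘ} ons run
    in τₘ-sorted , τₘ-coincides ,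
       λ σ σ-sorted σ-coincides →
         sorted-unique {σ = σ} {ρ = τₘ} {τ₀ = τ₀} (Interval? a n′)
                       σ-sorted τₘ-sorted σ-coincides τₘ-coincides
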